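{- Let $G$ be a graph with $n\geq 1$ vertices and minimum degree $\delta$, and let $t\geq 1$ be an integer with $2\delta-n\geq t-2$. Then $G$ contains every 2-degenerate graph on $t$ vertices as a subgraph.
   Context: All graphs are finite and simple. A graph is 2-degenerate if every non-empty subgraph of it has a vertex of degree at most 2. -}

module Defs where

open import Data.Nat using (ℕ; _≤_)
open import Data.Bool using (Bool; true; false; T)
open import Data.Fin using (Fin)
open import Data.Fin.Subset using (Subset; _∈_; Nonempty)
open import Data.Vec using (tabulate)
open import Data.Product using (Σ; _×_; ∃-syntax)
open import Relation.Binary.PropositionalEquality using (_≡_)
open import Relation.Nullary using (¬_)
open import Function.Definitions using (Injective)
import Data.Fin.Subset as S

record Graph (n : ℕ) : Set where
  field
    adj   : Fin n → Fin n → Bool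
    sym   : ∀ u v → adj u v ≡ adj v u
    irrefl : ∀ v → adj v v ≡ false
open Graph public

nbhd : ∀ {n} → Graph n → Fin n → Subset n
nbhd G v = tabulate (λ u → adj G v u)

deg : ∀ {n} → Graph n → Fin n → ℕ
deg G v = S.∣ nbhd G v ∣

IsMinDegree : ∀ {n} → Graph n → ℕ → Set
IsMinDegree G δ = (∀ v → δ ≤ deg G v) × ∃[ v ] deg G v ≡ δ

degIn : ∀ {n} → Graph n → Subset n → Fin n → ℕ
degIn G X v = S.∣ nbhd G v S.∩ X ∣

EdgeSub : ∀ {n} → Graph n → Graph n → Set
EdgeSub K G = ∀ u v → T (adj K u v) → T (adj G u v)

-- 2-degenerate: every non-empty subgraph has a vertex of degree ≤ 2.
-- A subgraph of H is given by a non-empty vertex set X together with a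
-- graph K ⊆ H on the same vertex set (only its edges inside X matter);
-- the degree of v in that subgraph is degIn K X v.
TwoDegenerate : ∀ {n} → Graph n → Set
TwoDegenerate {n} H =
  (K : Graph n) → EdgeSub K H → (X : Subset n) → Nonempty X →
  ∃[ v ] (v ∈ X × degIn K X v ≤ 2)

SubgraphOf : ∀ {t n} → Graph t → Graph n → Set
SubgraphOf {t} {n} H G =
  Σ (Fin t → Fin n) λ f →
    Injective _≡_ _≡_ f × (∀ u v → T (adj H u v) → T (adj G (f u) (f v)))

module Submission where

-- Since H is
-- 2-degenerate, every non-empty vertex set X of H contains a vertex v with
-- at most two neighbours in X; embed X - v first and then place v.  The ℓ ≤ 2
-- already embedded neighbours of v have at least n - ℓ(n - δ) common
-- neighbours in G (each vertex misses at most n - δ vertices).  None of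
-- these common neighbours is the image of one of those ℓ neighbours, so if
-- all of them were already used, the image would have at least
-- n - ℓ(n - δ) + ℓ ≤ |X| - 1 ≤ t - 1 elements, which the arithmetic
-- n + t ≤ 2δ + 2 (together with δ < n) rules out; so v is sent to a free
-- common neighbour.

open import Defs
open import Data.Nat using (ℕ; _≤_; _<_; _+_; _*_; _∸_; zero; suc; z≤n; s≤s)
open import Data.Nat.Properties
open import Data.Nat.Tactic.RingSolver using (solve-∀)
open import Data.Bool using (true; false; T)
open import Data.Bool.Properties using (T-≡)
open import Data.Fin using (Fin) renaming (zero to fzero; suc to fsuc)
open import Data.Fin.Properties using (any?) renaming (suc-injective to fsuc-injective; _≟_ to _≟ᶠ_)
open import Data.Fin.Subset
  using (Subset; _∈_; _∉_; _∩_; _∪_; _-_; _⊆_; ⊤; ⊥; ⁅_⁆; ∁; Nonempty)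
  renaming (∣_∣ to size)
open import Data.Fin.Subset.Properties
  using ( ∣p∣≤n; p⊆q⇒∣p∣≤∣q∣; p⊂q⇒∣p∣<∣q∣; x∈p⇒∣p-x∣<∣p∣; x∈p∧x≢y⇒x∈p-y
        ; x∈⁅x⁆; p─q⊆p; ∈⊤; ∣⊤∣≡n; ∣⊥∣≡0; ∣⁅x⁆∣≡1; ∣∁p∣≡n∸∣p∣; _∈?_; nonempty?
        ; x∈p∩q⁺; x∈p∩q⁻; x∈p∪q⁺)
open import Data.Vec.Base using (here; there; []; _∷_)
open import Data.Vec.Properties using (lookup∘tabulate; []=⇒lookup; lookup⇒[]=)
open import Data.List using (List; []; _∷_; map; length)
open import Data.List.Properties using (length-map)
open import Data.List.Membership.Propositional using () renaming (_∈_ to _∈ˡ_)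
open import Data.List.Membership.Propositional.Properties using (∈-map⁺; ∈-map⁻)
open import Data.List.Relation.Unary.Any using (here; there)
import Data.List.Relation.Unary.All as All
open import Data.List.Relation.Unary.AllPairs using ([]; _∷_)
open import Data.List.Relation.Unary.Unique.Propositional using (Unique)
open import Data.Product using (_×_; _,_; proj₁; proj₂)
open import Data.Sum using (_⊎_; inj₁; inj₂)
open import Data.Empty using (⊥-elim) renaming (⊥ to Empty)
open import Function.Bundles using (Equivalence)
open import Relation.Nullary using (¬_; yes; no; contradiction; ¬?; _×-dec_)
open import Relation.Binary.PropositionalEquality
  using (_≡_; _≢_; refl; cong; subst; trans) renaming (sym to ≡-sym)

∈nbhd⁺ : ∀ {n} (G : Graph n) {v u} → T (adj G v u) → u ∈ nbhd G v
∈nbhd⁺ G {v} {u} a = lookup⇒[]= u _ (trans (lookup∘tabulate (adj G v) u) (Equivalence.to T-≡ a))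

∈nbhd⁻ : ∀ {n} (G : Graph n) {v u} → u ∈ nbhd G v → T (adj G v u)
∈nbhd⁻ G {v} {u} m = Equivalence.from T-≡ (trans (≡-sym (lookup∘tabulate (adj G v) u)) ([]=⇒lookup m))

¬adj-self : ∀ {n} (G : Graph n) v → ¬ T (adj G v v)
¬adj-self G v a = subst T (irrefl G v) a

adj-sym : ∀ {n} (G : Graph n) {u v} → T (adj G u v) → T (adj G v u)
adj-sym G {u} {v} = subst T (Graph.sym G u v)

-- A vertex is not its own neighbour, so every degree is below n.
deg<n : ∀ {n} (G : Graph n) v → deg G v < n
deg<n {n} G v = ≤-trans (p⊂q⇒∣p∣<∣q∣ ((λ _ → ∈⊤) , v , ∈⊤ , v∉N)) (≤-reflexive (∣⊤∣≡n n))
  where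
  v∉N : v ∉ nbhd G v
  v∉N m = ¬adj-self G v (∈nbhd⁻ G m)

∣q∣≤∣p∩q∣+∣∁p∣ : ∀ {n} (p q : Subset n) → size q ≤ size (p ∩ q) + size (∁ p)
∣q∣≤∣p∩q∣+∣∁p∣ []          []          = z≤n
∣q∣≤∣p∩q∣+∣∁p∣ (true ∷ p)  (true ∷ q)  = s≤s (∣q∣≤∣p∩q∣+∣∁p∣ p q)
∣q∣≤∣p∩q∣+∣∁p∣ (true ∷ p)  (false ∷ q) = ∣q∣≤∣p∩q∣+∣∁p∣ p q
∣q∣≤∣p∩q∣+∣∁p∣ (false ∷ p) (true ∷ q)  =
  ≤-trans (s≤s (∣q∣≤∣p∩q∣+∣∁p∣ p q)) (≤-reflexive (≡-sym (+-suc _ _)))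
∣q∣≤∣p∩q∣+∣∁p∣ (false ∷ p) (false ∷ q) =
  ≤-trans (∣q∣≤∣p∩q∣+∣∁p∣ p q) (+-monoʳ-≤ _ (n≤1+n _))

∣p∪q∣≤∣p∣+∣q∣ : ∀ {n} (p q : Subset n) → size (p ∪ q) ≤ size p + size q
∣p∪q∣≤∣p∣+∣q∣ []          []          = z≤n
∣p∪q∣≤∣p∣+∣q∣ (true ∷ p)  (true ∷ q)  = s≤s (≤-trans (∣p∪q∣≤∣p∣+∣q∣ p q) (+-monoʳ-≤ _ (n≤1+n _)))
∣p∪q∣≤∣p∣+∣q∣ (true ∷ p)  (false ∷ q) = s≤s (∣p∪q∣≤∣p∣+∣q∣ p q)
∣p∪q∣≤∣p∣+∣q∣ (false ∷ p) (true ∷ q)  =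
  ≤-trans (s≤s (∣p∪q∣≤∣p∣+∣q∣ p q)) (≤-reflexive (≡-sym (+-suc _ _)))
∣p∪q∣≤∣p∣+∣q∣ (false ∷ p) (false ∷ q) = ∣p∪q∣≤∣p∣+∣q∣ p q

size-remove : ∀ {m k} {X : Subset m} {v} → v ∈ X → size X ≤ suc k → size (X - v) ≤ k
size-remove v∈X X≤1+k = ≤-pred (≤-trans (x∈p⇒∣p-x∣<∣p∣ v∈X) X≤1+k)

count-outside : ∀ {n} (I C : Subset n) (xs : List (Fin n)) → Unique xs →
                (∀ {x} → x ∈ˡ xs → x ∈ I) → (∀ {x} → x ∈ˡ xs → x ∉ C) → C ⊆ I →
                size C + length xs ≤ size I
count-outside I C [] _ _ _ C⊆I = ≤-trans (≤-reflexive (+-identityʳ _)) (p⊆q⇒∣p∣≤∣q∣ C⊆I)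
count-outside I C (x ∷ xs) (x∉xs ∷ uniq) inI notC C⊆I =
  ≤-trans (≤-reflexive (+-suc (size C) (length xs)))
          (≤-trans (s≤s rest) (x∈p⇒∣p-x∣<∣p∣ (inI (here refl))))
  where
  -- The remaining elements and C all lie in I - x.
  rest : size C + length xs ≤ size (I - x)
  rest = count-outside (I - x) C xs uniq
           (λ m → x∈p∧x≢y⇒x∈p-y (inI (there m)) (λ y≡x → All.lookup x∉xs m (≡-sym y≡x)))
           (λ m → notC (there m))
           (λ {c} c∈C → x∈p∧x≢y⇒x∈p-y (C⊆I c∈C) (λ c≡x → notC (here refl) (subst (_∈ C) c≡x c∈C)))

map-unique : ∀ {A B : Set} (f : A → B) (xs : List A) →
             (∀ {x y} → x ∈ˡ xs → y ∈ˡ xs → f x ≡ f y → x ≡ y) →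
             Unique xs → Unique (map f xs)
map-unique f []       _   []           = []
map-unique f (x ∷ xs) inj (x∉xs ∷ uniq) =
  All.tabulate fresh ∷ map-unique f xs (λ m m′ → inj (there m) (there m′)) uniq
  where
  fresh : ∀ {z} → z ∈ˡ map f xs → f x ≢ z
  fresh m fx≡z with ∈-map⁻ f m
  ... | y , y∈xs , refl = All.lookup x∉xs y∈xs (inj (here refl) (there y∈xs) fx≡z)

-- The elements of a subset as a duplicate-free list, so that the few
-- neighbours of a vertex can be mapped and counted one by one.
elements : ∀ {n} → Subset n → List (Fin n)
elements []          = []
elements (true ∷ p)  = fzero ∷ map fsuc (elements p)
elements (false ∷ p) = map fsuc (elements p)

length-elements : ∀ {n} (p : Subset n) → length (elements p) ≡ size p
length-elements []          = refl
length-elements (true ∷ p)  = cong suc (trans (length-map fsuc (elements p)) (length-elements p))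
length-elements (false ∷ p) = trans (length-map fsuc (elements p)) (length-elements p)

∈elements⁺ : ∀ {n} {p : Subset n} {x} → x ∈ p → x ∈ˡ elements p
∈elements⁺ {p = true ∷ p}  here      = here refl
∈elements⁺ {p = true ∷ p}  (there m) = there (∈-map⁺ fsuc (∈elements⁺ m))
∈elements⁺ {p = false ∷ p} (there m) = ∈-map⁺ fsuc (∈elements⁺ m)

∈elements⁻ : ∀ {n} (p : Subset n) {x} → x ∈ˡ elements p → x ∈ p
∈elements⁻ (true ∷ p) (here refl) = here
∈elements⁻ (true ∷ p) (there m) with ∈-map⁻ fsuc m
... | _ , m′ , refl = there (∈elements⁻ p m′)
∈elements⁻ (false ∷ p) m with ∈-map⁻ fsuc m
... | _ , m′ , refl = there (∈elements⁻ p m′)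

elements-unique : ∀ {n} (p : Subset n) → Unique (elements p)
elements-unique []          = []
elements-unique (true ∷ p)  =
  All.tabulate zero∉ ∷ map-unique fsuc _ (λ _ _ → fsuc-injective) (elements-unique p)
  where
  zero∉ : ∀ {y} → y ∈ˡ map fsuc (elements p) → fzero ≢ y
  zero∉ m 0≡y with ∈-map⁻ fsuc m
  zero∉ m () | _ , _ , refl
elements-unique (false ∷ p) = map-unique fsuc _ (λ _ _ → fsuc-injective) (elements-unique p)

commonNbhd : ∀ {n} → Graph n → List (Fin n) → Subset n
commonNbhd G []       = ⊤
commonNbhd G (y ∷ ys) = nbhd G y ∩ commonNbhd G ys

commonNbhd-adj : ∀ {n} (G : Graph n) ys {w y} → w ∈ commonNbhd G ys → y ∈ˡ ys → T (adj G y w)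
commonNbhd-adj G (y ∷ ys) m (here refl) = ∈nbhd⁻ G (proj₁ (x∈p∩q⁻ (nbhd G y) _ m))
commonNbhd-adj G (y ∷ ys) m (there k)   = commonNbhd-adj G ys (proj₂ (x∈p∩q⁻ (nbhd G y) _ m)) k

-- Each vertex of minimum degree ≥ δ misses at most n ∸ δ vertices, so ℓ
-- vertices have at least n - ℓ(n ∸ δ) common neighbours.
commonNbhd-size : ∀ {n} (G : Graph n) δ → (∀ v → δ ≤ deg G v) → ∀ ys →
                  n ≤ size (commonNbhd G ys) + length ys * (n ∸ δ)
commonNbhd-size {n} G δ minDeg [] = ≤-trans (≤-reflexive (≡-sym (∣⊤∣≡n n))) (m≤m+n _ _)
commonNbhd-size {n} G δ minDeg (y ∷ ys) = begin
  n                                    ≤⟨ commonNbhd-size G δ minDeg ys ⟩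
  size B + length ys * d               ≤⟨ +-monoˡ-≤ _ lose-at-most-d ⟩
  (size (A ∩ B) + d) + length ys * d   ≡⟨ +-assoc (size (A ∩ B)) d _ ⟩
  size (A ∩ B) + length (y ∷ ys) * d   ∎
  where
  open ≤-Reasoning
  A = nbhd G y
  B = commonNbhd G ys
  d = n ∸ δ
  lose-at-most-d : size B ≤ size (A ∩ B) + d
  lose-at-most-d = ≤-trans (∣q∣≤∣p∩q∣+∣∁p∣ A B)
    (+-monoʳ-≤ _ (≤-trans (≤-reflexive (∣∁p∣≡n∸∣p∣ A)) (∸-monoʳ-≤ n (minDeg y))))

deficiency-slack : ∀ ℓ d → ℓ ≤ 2 → 1 ≤ d → ℓ * d + 1 < 2 * d + ℓ
deficiency-slack 0 d _ 1≤d = ≤-trans (*-monoʳ-≤ 2 1≤d) (m≤m+n (2 * d) 0)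
deficiency-slack 1 (suc e) _ _ = +-monoˡ-< 1 (*-monoˡ-< (suc e) (n<1+n 1))
deficiency-slack 2 d _ _ = ≤-reflexive (≡-sym (+-suc (2 * d) 1))
deficiency-slack (suc (suc (suc _))) _ (s≤s (s≤s ())) _

-- If the ℓ ≤ 2 neighbours' common neighbourhood C were used up (|C| + ℓ < t),
-- the bound n ≤ |C| + ℓ(n ∸ δ) would contradict n + t ≤ 2δ + 2.
no-room : ∀ {n δ t} c ℓ → δ < n → ℓ ≤ 2 → n ≤ c + ℓ * (n ∸ δ) → c + ℓ < t →
          n + t ≤ 2 * δ + 2 → Empty
no-room {n} {δ} {t} c ℓ δ<n ℓ≤2 common used room =
  <-irrefl refl (≤-trans (deficiency-slack ℓ d ℓ≤2 (m<n⇒0<n∸m δ<n))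
                         (+-cancelˡ-≤ (2 * δ + t + 1) _ _ combined))
  where
  d = n ∸ δ
  n≡δ+d : n ≡ δ + d
  n≡δ+d = ≡-sym (m+[n∸m]≡n (<⇒≤ δ<n))
  first : δ + d + (ℓ + 1) ≤ ℓ * d + t
  first = begin
    δ + d + (ℓ + 1)       ≡⟨ cong (_+ (ℓ + 1)) (≡-sym n≡δ+d) ⟩
    n + (ℓ + 1)           ≤⟨ +-monoˡ-≤ (ℓ + 1) common ⟩
    c + ℓ * d + (ℓ + 1)   ≡⟨ regroup c ℓ d ⟩
    ℓ * d + (c + ℓ + 1)   ≤⟨ +-monoʳ-≤ (ℓ * d) (≤-trans (≤-reflexive (+-comm (c + ℓ) 1)) used) ⟩
    ℓ * d + t             ∎
    where
    open ≤-Reasoning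
    regroup : ∀ c ℓ d → c + ℓ * d + (ℓ + 1) ≡ ℓ * d + (c + ℓ + 1)
    regroup = solve-∀
  -- Adding n + t ≤ 2δ + 2 leaves, after cancelling 2δ + t + 1,
  -- the bound 2d + ℓ ≤ ℓd + 1 that contradicts the slack.
  combined : 2 * δ + t + 1 + (2 * d + ℓ) ≤ 2 * δ + t + 1 + (ℓ * d + 1)
  combined = begin
    2 * δ + t + 1 + (2 * d + ℓ)       ≡⟨ lhs δ d ℓ t ⟩
    δ + d + (ℓ + 1) + (δ + d + t)     ≤⟨ +-mono-≤ first (≤-trans (≤-reflexive (cong (_+ t) (≡-sym n≡δ+d))) room) ⟩
    ℓ * d + t + (2 * δ + 2)           ≡⟨ rhs δ d ℓ t ⟩
    2 * δ + t + 1 + (ℓ * d + 1)       ∎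
    where
    open ≤-Reasoning
    lhs : ∀ δ d ℓ t → 2 * δ + t + 1 + (2 * d + ℓ) ≡ δ + d + (ℓ + 1) + (δ + d + t)
    lhs = solve-∀
    rhs : ∀ δ d ℓ t → ℓ * d + t + (2 * δ + 2) ≡ 2 * δ + t + 1 + (ℓ * d + 1)
    rhs = solve-∀

module PartialEmbeddings {n t} (G : Graph n) (H : Graph t) where

  record PartialEmbedding (X : Subset t) : Set where
    field
      φ           : Fin t → Fin n
      used        : Subset n
      φ-used      : ∀ {u} → u ∈ X → φ u ∈ used
      used-size   : size used ≤ size X
      φ-injective : ∀ {u u′} → u ∈ X → u′ ∈ X → φ u ≡ φ u′ → u ≡ u′
      φ-adj       : ∀ {u u′} → u ∈ X → u′ ∈ X → T (adj H u u′) → T (adj G (φ u) (φ u′))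

  trivial : Fin n → ∀ X → ¬ Nonempty X → PartialEmbedding X
  trivial v₀ X empty = record
    { φ           = λ _ → v₀
    ; used        = ⊥
    ; φ-used      = λ u∈X → absurd u∈X
    ; used-size   = ≤-trans (≤-reflexive (∣⊥∣≡0 n)) z≤n
    ; φ-injective = λ u∈X _ _ → absurd u∈X
    ; φ-adj       = λ u∈X _ _ → absurd u∈X
    }
    where
    absurd : ∀ {A : Set} {u} → u ∈ X → A
    absurd u∈X = ⊥-elim (empty (_ , u∈X))

  extend : ∀ {X v} → v ∈ X → (E : PartialEmbedding (X - v)) → ∀ w →
           w ∉ PartialEmbedding.used E →
           (∀ {u} → u ∈ X - v → T (adj H v u) → T (adj G w (PartialEmbedding.φ E u))) →
           PartialEmbedding X
  extend {X} {v} v∈X E w w∉used fits = record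
    { φ           = φ′
    ; used        = used ∪ ⁅ w ⁆
    ; φ-used      = φ′-used
    ; used-size   = used′-size
    ; φ-injective = φ′-injective
    ; φ-adj       = φ′-adj
    }
    where
    open PartialEmbedding E

    φ′ : Fin t → Fin n
    φ′ u with u ≟ᶠ v
    ... | yes _ = w
    ... | no  _ = φ u

    φ′-cases : ∀ u → (u ≡ v × φ′ u ≡ w) ⊎ (u ≢ v × φ′ u ≡ φ u)
    φ′-cases u with u ≟ᶠ v
    ... | yes u≡v = inj₁ (u≡v , refl)
    ... | no  u≢v = inj₂ (u≢v , refl)

    old : ∀ {u} → u ∈ X → u ≢ v → u ∈ X - v
    old = x∈p∧x≢y⇒x∈p-y

    w-fresh : ∀ {u} → u ∈ X → u ≢ v → w ≢ φ u
    w-fresh u∈X u≢v w≡φu = w∉used (subst (_∈ used) (≡-sym w≡φu) (φ-used (old u∈X u≢v)))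

    φ′-used : ∀ {u} → u ∈ X → φ′ u ∈ used ∪ ⁅ w ⁆
    φ′-used {u} u∈X with φ′-cases u
    ... | inj₁ (_ , φ′u≡w)     = subst (_∈ used ∪ ⁅ w ⁆) (≡-sym φ′u≡w) (x∈p∪q⁺ (inj₂ (x∈⁅x⁆ w)))
    ... | inj₂ (u≢v , φ′u≡φu) = subst (_∈ used ∪ ⁅ w ⁆) (≡-sym φ′u≡φu) (x∈p∪q⁺ (inj₁ (φ-used (old u∈X u≢v))))

    used′-size : size (used ∪ ⁅ w ⁆) ≤ size X
    used′-size = begin
      size (used ∪ ⁅ w ⁆)     ≤⟨ ∣p∪q∣≤∣p∣+∣q∣ used ⁅ w ⁆ ⟩
      size used + size ⁅ w ⁆  ≡⟨ trans (cong (size used +_) (∣⁅x⁆∣≡1 w)) (+-comm (size used) 1) ⟩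
      suc (size used)         ≤⟨ s≤s used-size ⟩
      suc (size (X - v))      ≤⟨ x∈p⇒∣p-x∣<∣p∣ v∈X ⟩
      size X                  ∎
      where open ≤-Reasoning

    φ′-injective : ∀ {u u′} → u ∈ X → u′ ∈ X → φ′ u ≡ φ′ u′ → u ≡ u′
    φ′-injective {u} {u′} u∈X u′∈X eq with φ′-cases u | φ′-cases u′
    ... | inj₁ (u≡v , _) | inj₁ (u′≡v , _) = trans u≡v (≡-sym u′≡v)
    ... | inj₁ (_ , φ′u≡w) | inj₂ (u′≢v , φ′u′≡φu′) =
      contradiction (trans (≡-sym φ′u≡w) (trans eq φ′u′≡φu′)) (w-fresh u′∈X u′≢v)
    ... | inj₂ (u≢v , φ′u≡φu) | inj₁ (_ , φ′u′≡w) =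
      contradiction (trans (≡-sym φ′u′≡w) (trans (≡-sym eq) φ′u≡φu)) (w-fresh u∈X u≢v)
    ... | inj₂ (u≢v , φ′u≡φu) | inj₂ (u′≢v , φ′u′≡φu′) =
      φ-injective (old u∈X u≢v) (old u′∈X u′≢v) (trans (≡-sym φ′u≡φu) (trans eq φ′u′≡φu′))

    φ′-adj : ∀ {u u′} → u ∈ X → u′ ∈ X → T (adj H u u′) → T (adj G (φ′ u) (φ′ u′))
    φ′-adj {u} {u′} u∈X u′∈X a with φ′-cases u | φ′-cases u′
    ... | inj₁ (refl , _) | inj₁ (refl , _) = ⊥-elim (¬adj-self H v a)
    ... | inj₁ (refl , φ′u≡w) | inj₂ (u′≢v , φ′u′≡φu′) rewrite φ′u≡w | φ′u′≡φu′ =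
      fits (old u′∈X u′≢v) a
    ... | inj₂ (u≢v , φ′u≡φu) | inj₁ (refl , φ′u′≡w) rewrite φ′u≡φu | φ′u′≡w =
      adj-sym G (fits (old u∈X u≢v) (adj-sym H a))
    ... | inj₂ (u≢v , φ′u≡φu) | inj₂ (u′≢v , φ′u′≡φu′) rewrite φ′u≡φu | φ′u′≡φu′ =
      φ-adj (old u∈X u≢v) (old u′∈X u′≢v) a

module Greedy {n t} (G : Graph n) (H : Graph t) (δ : ℕ)
              (minDeg : ∀ v → δ ≤ deg G v) (δ<n : δ < n) (room : n + t ≤ 2 * δ + 2) where

  open PartialEmbeddings G H

  module Placement {X v} (v∈X : v ∈ X) (deg≤2 : degIn H X v ≤ 2)
                   (E : PartialEmbedding (X - v)) where
    open PartialEmbedding E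

    N : Subset t
    N = nbhd H v ∩ X

    neighbours : List (Fin t)
    neighbours = elements N

    C : Subset n
    C = commonNbhd G (map φ neighbours)

    neighbour-adj : ∀ {u} → u ∈ˡ neighbours → T (adj H v u)
    neighbour-adj m = ∈nbhd⁻ H (proj₁ (x∈p∩q⁻ (nbhd H v) X (∈elements⁻ N m)))

    neighbour-old : ∀ {u} → u ∈ˡ neighbours → u ∈ X - v
    neighbour-old m = x∈p∧x≢y⇒x∈p-y (proj₂ (x∈p∩q⁻ (nbhd H v) X (∈elements⁻ N m)))
                                     (λ { refl → ¬adj-self H v (neighbour-adj m) })

    C-fits : ∀ {w} → w ∈ C → ∀ {u} → u ∈ X - v → T (adj H v u) → T (adj G w (φ u))
    C-fits w∈C {u} u∈X-v a = adj-sym G (commonNbhd-adj G (map φ neighbours) w∈C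
      (∈-map⁺ φ (∈elements⁺ (x∈p∩q⁺ (∈nbhd⁺ H a , p─q⊆p X ⁅ v ⁆ u∈X-v)))))

    -- C cannot consist of used vertices only: the images of the ≤ 2
    -- neighbours are used but lie outside C, which leaves too little room.
    C⊈used : C ⊆ used → Empty
    C⊈used C⊆used = no-room (size C) ℓ δ<n ℓ≤2 common-bound used-up room
      where
      ℓ = length neighbours
      images = map φ neighbours
      length-images : length images ≡ ℓ
      length-images = length-map φ neighbours
      ℓ≤2 : ℓ ≤ 2
      ℓ≤2 = ≤-trans (≤-reflexive (length-elements N)) deg≤2
      common-bound : n ≤ size C + ℓ * (n ∸ δ)
      common-bound = subst (λ k → n ≤ size C + k * (n ∸ δ)) length-images
                           (commonNbhd-size G δ minDeg images)
      images-unique : Unique images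
      images-unique = map-unique φ neighbours
        (λ m m′ → φ-injective (neighbour-old m) (neighbour-old m′)) (elements-unique N)
      image-used : ∀ {y} → y ∈ˡ images → y ∈ used
      image-used m with ∈-map⁻ φ m
      ... | u , u∈ , refl = φ-used (neighbour-old u∈)
      image-outside : ∀ {y} → y ∈ˡ images → y ∉ C
      image-outside {y} m y∈C = ¬adj-self G y (commonNbhd-adj G images y∈C m)
      used-up : size C + ℓ < t
      used-up = begin-strict
        size C + ℓ               ≡⟨ cong (size C +_) (≡-sym length-images) ⟩
        size C + length images   ≤⟨ count-outside used C images images-unique image-used image-outside C⊆used ⟩
        size used                ≤⟨ used-size ⟩
        size (X - v)             <⟨ x∈p⇒∣p-x∣<∣p∣ v∈X ⟩
        size X                   ≤⟨ ∣p∣≤n X ⟩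
        t                        ∎
        where open ≤-Reasoning

    placed : PartialEmbedding X
    placed with any? (λ w → (w ∈? C) ×-dec ¬? (w ∈? used))
    ... | yes (w , w∈C , w∉used) = extend v∈X E w w∉used (C-fits w∈C)
    ... | no none = ⊥-elim (C⊈used C⊆used)
      where
      C⊆used : C ⊆ used
      C⊆used {w} w∈C with w ∈? used
      ... | yes w∈used = w∈used
      ... | no  w∉used = ⊥-elim (none (w , w∈C , w∉used))

  embed : Fin n → TwoDegenerate H → ∀ k X → size X ≤ k → PartialEmbedding X
  embed v₀ degen k X X≤k with nonempty? X
  embed v₀ degen k       X _   | no empty = trivial v₀ X empty
  embed v₀ degen zero    X X≤0 | yes (u , u∈X) = ⊥-elim (n≮0 (≤-trans (x∈p⇒∣p-x∣<∣p∣ u∈X) X≤0))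
  embed v₀ degen (suc k) X X≤k | yes ne with degen H (λ _ _ a → a) X ne
  ... | v , v∈X , deg≤2 =
    Placement.placed v∈X deg≤2 (embed v₀ degen k (X - v) (size-remove v∈X X≤k))

lemma10 : (n : ℕ) → 1 ≤ n → (G : Graph n) → (δ : ℕ) → IsMinDegree G δ →
          (t : ℕ) → 1 ≤ t → n + t ≤ 2 * δ + 2 →
          (H : Graph t) → TwoDegenerate H → SubgraphOf H G
lemma10 n _ G δ (minDeg , v₀ , deg-v₀≡δ) t _ room H degen =
  φ , (λ eq → φ-injective ∈⊤ ∈⊤ eq) , (λ _ _ a → φ-adj ∈⊤ ∈⊤ a)
  where
  -- The minimum degree is attained, and every degree is below n.
  δ<n : δ < n
  δ<n = subst (_< n) deg-v₀≡δ (deg<n G v₀)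

  open Greedy G H δ minDeg δ<n room
  open PartialEmbeddings.PartialEmbedding
         (embed v₀ degen t ⊤ (≤-reflexive (∣⊤∣≡n t)))
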